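{- Let $\mathcal T$ be an irreducible planar or toric trinity and $s$ a state. Let $P$ and $P'$ be two paths in the state transition graph, both starting at $s$, such that for every black triangle $\Delta$ the exponent sum of $\Delta$ along $P$ equals the exponent sum of $\Delta$ along $P'$. Then $P$ and $P'$ end at the same state.
   Context: A trinity is a triangulation $\mathcal T$ of a compact connected oriented closed surface $\Sigma$ whose vertices are colored red, green, blue so that the endpoints of every edge have different colors. A triangle is black if its vertices, read clockwise, appear in the cyclic order blue, green, red; otherwise white. A toric trinity is a trinity on the torus; a planar trinity is a trinity on $S^2$ with a chosen white triangle called outer, whose vertices are called roots. A state of a toric trinity is a bijection between white triangles and vertices matching each white triangle with one of its own vertices; for a planar trinity, between non-outer white triangles and non-root vertices. Clock moves: for a black triangle $\Delta$ with vertices $u_1,u_2,u_3$ in clockwise order and $W_i$ the white triangle sharing the edge $u_iu_{i+1}$ with $\Delta$ (indices mod 3), $\Delta$ is a clockwise empty black triangle of $s$ if $s$ matches $W_i$ with $u_{i+1}$ for all $i$, and counter-clockwise empty if $s$ matches $W_i$ with $u_i$ for all $i$. The clockwise move changing a clockwise empty $\Delta$ replaces the pairs $(W_i,u_{i+1})$ by $(W_i,u_i)$ and leaves all other pairs unchanged; the counter-clockwise move changing $\Delta$ is its inverse. (In an irreducible trinity every clock move is of this form.) A path is a sequence of states in which consecutive ones are related by a clockwise or counter-clockwise move. The exponent sum of $\Delta$ along a path is the number of clockwise moves changing $\Delta$ minus the number of counter-clockwise moves changing $\Delta$ in the path. Irreducibility: let $\mathcal F$ be the planar trinity with three vertices and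 two triangles. For a trinity $\mathcal T$, a black triangle $\Delta$ of it and a planar trinity $\mathcal T_0$, the connected sum $\mathcal T\#\mathcal T_0$ is obtained by removing the interior of $\Delta$ and gluing in $\mathcal T_0$ minus the interior of its outer triangle, matching colors on the boundary. It is trivial if $\mathcal T$ or $\mathcal T_0$ is $\mathcal F$. A trinity is irreducible if it is not $\mathcal F$ and is not a nontrivial connected sum. -}

module Defs where

open import Data.Nat using (ℕ; zero; suc; _+_; _*_)
open import Data.Fin using (Fin; zero; suc; _≟_)
open import Data.Integer using (ℤ; 0ℤ; 1ℤ; -_) renaming (_+_ to _+ℤ_)
open import Data.Product using (Σ; ∃; ∃-syntax; _×_; _,_; proj₁; proj₂)
open import Data.Sum using (_⊎_)
open import Data.Unit using (⊤)
open import Relation.Nullary using (¬_; yes; no)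
open import Relation.Binary.PropositionalEquality using (_≡_; _≢_)

-- A surface is built from F triangles, each with corners 0,1,2 listed in
-- CLOCKWISE order.  Side (t , i) of triangle t is the edge from corner i to
-- corner (next i).  The sides are glued in pairs by a fixed-point-free
-- involution `glue`; gluing always reverses the direction of the side, so
-- the resulting closed surface is oriented (clockwise orientations agree).
-- If side (t , i) is glued to side (t' , j), corner (t , i) is identified
-- with corner (t' , next j) and corner (t , next i) with corner (t' , j).

next : Fin 3 → Fin 3
next zero = suc zero
next (suc zero) = suc (suc zero)
next (suc (suc zero)) = zero

Side : ℕ → Set
Side F = Fin F × Fin 3

-- rotation of corners around their common vertex
rot : {F : ℕ} → (Side F → Side F) → Side F → Side F
rot glue c = proj₁ (glue c) , next (proj₂ (glue c))

iter : {A : Set} → ℕ → (A → A) → A → A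
iter zero f x = x
iter (suc k) f x = f (iter k f x)

-- connectivity of the dual graph (triangles adjacent across sides)
data Reach {F : ℕ} (glue : Side F → Side F) : Fin F → Fin F → Set where
  here : ∀ {t} → Reach glue t t
  step : ∀ {t t'} (i : Fin 3) → Reach glue (proj₁ (glue (t , i))) t' → Reach glue t t'

data Color : Set where
  red green blue : Color

-- A trinity: triangulation of a compact connected oriented closed surface
-- with a proper 3-colouring of its vertices.
record Trinity : Set where
  field
    F V        : ℕ
    glue       : Side F → Side F
    glue-invol : ∀ s → glue (glue s) ≡ s
    glue-nofix : ∀ s → glue s ≢ s
    connected  : ∀ t t' → Reach glue t t'
    -- vertices = orbits of corners under rotation around the vertex
    vert       : Side F → Fin V
    vert-rot   : ∀ c → vert (rot glue c) ≡ vert c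
    vert-orbit : ∀ c c' → vert c ≡ vert c' → ∃[ k ] iter k (rot glue) c ≡ c'
    vert-surj  : ∀ v → ∃[ c ] vert c ≡ v
    col        : Fin V → Color
    proper     : ∀ t i → col (vert (t , i)) ≢ col (vert (t , next i))

  colC : Side F → Color
  colC c = col (vert c)

  Black : Fin F → Set
  Black t = ∃[ i ] (colC (t , i) ≡ blue × colC (t , next i) ≡ green
                    × colC (t , next (next i)) ≡ red)

  White : Fin F → Set
  White t = ¬ Black t

  -- Euler characteristic: χ = V - E + F = V - F/2 (E = 3F/2)
  -- sphere: χ = 2 ;  torus: χ = 0
  OnSphere : Set
  OnSphere = 2 * V ≡ F + 4

  OnTorus : Set
  OnTorus = 2 * V ≡ F

open Trinity

IsF : Trinity → Set
IsF T = F T ≡ 2 × V T ≡ 3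

-- Connected sum  T ≅ T₁ # T₀ , glued at the black triangle Δ of T₁ and the
-- outer triangle o of the planar trinity T₀ (matching colours on the
-- boundary).  Given up to isomorphism: the triangles of T are exactly the
-- images under a of triangles of T₁ other than Δ, and under b of triangles of
-- T₀ other than o, with corner labels, gluings and colours preserved, and the
-- sides formerly glued to Δ glued to the sides formerly glued to o, along
-- the colour-matching identification of the boundaries.

record IsConnectedSum (T T₁ : Trinity) (Δ : Fin (F T₁)) (T₀ : Trinity) (o : Fin (F T₀)) : Set where
  field
    a : Fin (F T₁) → Fin (F T)
    b : Fin (F T₀) → Fin (F T)
    a-inj : ∀ t t' → t ≢ Δ → t' ≢ Δ → a t ≡ a t' → t ≡ t'
    b-inj : ∀ t t' → t ≢ o → t' ≢ o → b t ≡ b t' → t ≡ t'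
    disjoint : ∀ t₁ t₀ → t₁ ≢ Δ → t₀ ≢ o → a t₁ ≢ b t₀
    cover : ∀ t → (∃[ t₁ ] (t₁ ≢ Δ × a t₁ ≡ t)) ⊎ (∃[ t₀ ] (t₀ ≢ o × b t₀ ≡ t))
    a-col : ∀ t i → t ≢ Δ → colC T (a t , i) ≡ colC T₁ (t , i)
    b-col : ∀ t i → t ≢ o → colC T (b t , i) ≡ colC T₀ (t , i)
    a-glue : ∀ t i → t ≢ Δ → proj₁ (glue T₁ (t , i)) ≢ Δ →
             glue T (a t , i) ≡ (a (proj₁ (glue T₁ (t , i))) , proj₂ (glue T₁ (t , i)))
    b-glue : ∀ t i → t ≢ o → proj₁ (glue T₀ (t , i)) ≢ o →
             glue T (b t , i) ≡ (b (proj₁ (glue T₀ (t , i))) , proj₂ (glue T₀ (t , i)))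
    -- side k of Δ runs (clockwise) from colour c to colour c'; it is matched
    -- with the side k' of o running from c' to c.
    seam : ∀ k k' → colC T₀ (o , k') ≡ colC T₁ (Δ , next k) →
           glue T (a (proj₁ (glue T₁ (Δ , k))) , proj₂ (glue T₁ (Δ , k)))
             ≡ (b (proj₁ (glue T₀ (o , k'))) , proj₂ (glue T₀ (o , k')))

NontrivialConnectedSum : Trinity → Set
NontrivialConnectedSum T =
  Σ Trinity λ T₁ → Σ (Fin (F T₁)) λ Δ → Black T₁ Δ ×
  Σ Trinity λ T₀ → Σ (Fin (F T₀)) λ o → OnSphere T₀ × White T₀ o ×
  IsConnectedSum T T₁ Δ T₀ o × ¬ IsF T₁ × ¬ IsF T₀

Irreducible : Trinity → Set
Irreducible T = ¬ IsF T × ¬ NontrivialConnectedSum T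

data Frame (T : Trinity) : Set where
  toric  : OnTorus T → Frame T
  planar : OnSphere T → (o : Fin (F T)) → White T o → Frame T   -- o = outer

-- white triangles taking part in states (non-outer white triangles)
RelTri : {T : Trinity} → Frame T → Fin (F T) → Set
RelTri {T} (toric _) t = White T t
RelTri {T} (planar _ o _) t = White T t × t ≢ o

-- vertices taking part in states (non-root vertices)
RelVert : {T : Trinity} → Frame T → Fin (V T) → Set
RelVert (toric _) v = ⊤
RelVert {T} (planar _ o _) v = ∀ i → v ≢ vert T (o , i)

module _ {T : Trinity} (fr : Frame T) where

  -- a state: each relevant white triangle t is matched with its own vertex
  -- vert T (t , m t); this matching is a bijection onto the relevant vertices
  -- (the values of m on other triangles are irrelevant).
  record IsState (m : Fin (F T) → Fin 3) : Set where
    field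
      into : ∀ t → RelTri fr t → RelVert fr (vert T (t , m t))
      inj  : ∀ t t' → RelTri fr t → RelTri fr t' → vert T (t , m t) ≡ vert T (t' , m t') → t ≡ t'
      surj : ∀ v → RelVert fr v → ∃[ t ] (RelTri fr t × vert T (t , m t) ≡ v)

  State : Set
  State = Σ (Fin (F T) → Fin 3) IsState

  Matches : State → Fin (F T) → Fin (V T) → Set
  Matches s W v = RelTri fr W × vert T (W , proj₁ s W) ≡ v

  SameState : State → State → Set
  SameState s s' = ∀ t → RelTri fr t → vert T (t , proj₁ s t) ≡ vert T (t , proj₁ s' t)

  Wtri : Fin (F T) → Fin 3 → Fin (F T)
  Wtri Δ i = proj₁ (glue T (Δ , i))

  u : Fin (F T) → Fin 3 → Fin (V T)
  u Δ i = vert T (Δ , i)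

  ClockwiseEmpty : State → Fin (F T) → Set
  ClockwiseEmpty s Δ = Black T Δ × (∀ i → Matches s (Wtri Δ i) (u Δ (next i)))

  CounterClockwiseEmpty : State → Fin (F T) → Set
  CounterClockwiseEmpty s Δ = Black T Δ × (∀ i → Matches s (Wtri Δ i) (u Δ i))

  CWMove : Fin (F T) → State → State → Set
  CWMove Δ s s' = ClockwiseEmpty s Δ
                × (∀ i → Matches s' (Wtri Δ i) (u Δ i))
                × (∀ t → RelTri fr t → (∀ i → t ≢ Wtri Δ i) →
                     vert T (t , proj₁ s' t) ≡ vert T (t , proj₁ s t))

  CCWMove : Fin (F T) → State → State → Set
  CCWMove Δ s s' = CWMove Δ s' s

  data Path : State → State → Set where
    []  : ∀ {s} → Path s s
    cw  : ∀ {s s' s''} (Δ : Fin (F T)) → CWMove Δ s s' → Path s' s'' → Path s s''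
    ccw : ∀ {s s' s''} (Δ : Fin (F T)) → CCWMove Δ s s' → Path s' s'' → Path s s''

  exponentSum : ∀ {s s'} → Path s s' → Fin (F T) → ℤ
  exponentSum [] t = 0ℤ
  exponentSum (cw Δ _ p) t with Δ ≟ t
  ... | yes _ = 1ℤ +ℤ exponentSum p t
  ... | no _  = exponentSum p t
  exponentSum (ccw Δ _ p) t with Δ ≟ t
  ... | yes _ = (- 1ℤ) +ℤ exponentSum p t
  ... | no _  = exponentSum p t

module Submission where

-- A state s assigns to every relevant white triangle t a corner
-- of t, its "pointer" (the corner carrying the vertex matched with t).  A
-- clock move changing a black triangle Δ only touches the three white
-- neighbours of Δ, and turns the pointer of each of them by one step: a
-- clockwise move from the start to the end of the side shared with Δ, a
-- counter-clockwise move back.  Letting ℤ act on the corners {0,1,2} by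
-- cyclic shifts, the pointer of t after a path P is therefore the initial
-- pointer shifted by the sum of the exponent sums along P of the three
-- neighbours of t.  Exponent sums of white triangles are always zero, so two
-- paths from s whose exponent sums agree on black triangles agree on all
-- triangles, shift every pointer by the same amount and end at the same state.

open import Defs
open import Data.Fin using (Fin)
open import Relation.Binary.PropositionalEquality using (_≡_)

open import Data.Nat using (zero; suc)
open import Data.Fin using (zero; suc; _≟_)
open import Data.Fin.Properties using (any?)
open import Data.Integer using (ℤ; +_; -[1+_]; 0ℤ; 1ℤ; -_) renaming (_+_ to _+ℤ_)
import Data.Integer.Properties as ℤP
open import Data.Integer.Tactic.RingSolver using (solve-∀)
open import Data.Empty using (⊥-elim)
open import Data.Product using (_×_; _,_; proj₁; proj₂)
open import Relation.Nullary using (Dec; yes; no)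
open import Relation.Nullary.Decidable.Core using (_×-dec_)
open import Relation.Binary.PropositionalEquality
  using (refl; sym; trans; cong; subst; subst₂; _≢_; module ≡-Reasoning)
open import Algebra.Properties.CommutativeMonoid.Sum ℤP.+-0-commutativeMonoid
  using (sum; sum-cong-≗; ∑-distrib-+)
open Trinity
open ≡-Reasoning

prev : Fin 3 → Fin 3
prev zero = suc (suc zero)
prev (suc zero) = zero
prev (suc (suc zero)) = suc zero

prev-next : ∀ x → prev (next x) ≡ x
prev-next zero = refl
prev-next (suc zero) = refl
prev-next (suc (suc zero)) = refl

next-prev : ∀ x → next (prev x) ≡ x
next-prev zero = refl
next-prev (suc zero) = refl
next-prev (suc (suc zero)) = refl

rotate : ℤ → Fin 3 → Fin 3
rotate (+ n) x = iter n next x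
rotate -[1+ n ] x = iter (suc n) prev x

rotate-1+ : ∀ b x → rotate (1ℤ +ℤ b) x ≡ next (rotate b x)
rotate-1+ (+ n) x = refl
rotate-1+ -[1+ zero ] x = sym (next-prev x)
rotate-1+ -[1+ suc n ] x = sym (next-prev _)

rotate--1+ : ∀ b x → rotate ((- 1ℤ) +ℤ b) x ≡ prev (rotate b x)
rotate--1+ (+ zero) x = refl
rotate--1+ (+ suc n) x = sym (prev-next _)
rotate--1+ -[1+ n ] x = refl

rotate-+ : ∀ a b x → rotate (a +ℤ b) x ≡ rotate a (rotate b x)
rotate-+ (+ zero) b x = cong (λ c → rotate c x) (ℤP.+-identityˡ b)
rotate-+ (+ suc n) b x = begin
  rotate ((1ℤ +ℤ + n) +ℤ b) x   ≡⟨ cong (λ c → rotate c x) (ℤP.+-assoc 1ℤ (+ n) b) ⟩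
  rotate (1ℤ +ℤ (+ n +ℤ b)) x   ≡⟨ rotate-1+ (+ n +ℤ b) x ⟩
  next (rotate (+ n +ℤ b) x)    ≡⟨ cong next (rotate-+ (+ n) b x) ⟩
  next (rotate (+ n) (rotate b x)) ∎
rotate-+ -[1+ zero ] b x = rotate--1+ b x
rotate-+ -[1+ suc n ] b x = begin
  rotate (((- 1ℤ) +ℤ -[1+ n ]) +ℤ b) x   ≡⟨ cong (λ c → rotate c x) (ℤP.+-assoc (- 1ℤ) -[1+ n ] b) ⟩
  rotate ((- 1ℤ) +ℤ (-[1+ n ] +ℤ b)) x   ≡⟨ rotate--1+ (-[1+ n ] +ℤ b) x ⟩
  prev (rotate (-[1+ n ] +ℤ b) x)        ≡⟨ cong prev (rotate-+ -[1+ n ] b x) ⟩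
  prev (rotate -[1+ n ] (rotate b x))    ∎

corner-injective : (T : Trinity) (t : Fin (F T)) {i j : Fin 3} →
                   vert T (t , i) ≡ vert T (t , j) → i ≡ j
corner-injective T t {i} {j} e = go i j e
  where
    clash : ∀ k → vert T (t , k) ≢ vert T (t , next k)
    clash k same = proper T t k (cong (col T) same)

    go : ∀ i j → vert T (t , i) ≡ vert T (t , j) → i ≡ j
    go zero zero _ = refl
    go (suc zero) (suc zero) _ = refl
    go (suc (suc zero)) (suc (suc zero)) _ = refl
    go zero (suc zero) e = ⊥-elim (clash zero e)
    go (suc zero) (suc (suc zero)) e = ⊥-elim (clash (suc zero) e)
    go (suc (suc zero)) zero e = ⊥-elim (clash (suc (suc zero)) e)
    go (suc zero) zero e = ⊥-elim (clash zero (sym e))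
    go (suc (suc zero)) (suc zero) e = ⊥-elim (clash (suc zero) (sym e))
    go zero (suc (suc zero)) e = ⊥-elim (clash (suc (suc zero)) (sym e))

-- Gluing reverses sides: the end of side c is the start of the side glued
-- to it.  (That the start of c is the end of the glued side is `vert-rot`.)
glued-side-start : (T : Trinity) (c : Side (F T)) →
                   vert T (glue T c) ≡ vert T (proj₁ c , next (proj₂ c))
glued-side-start T c = begin
  vert T (glue T c)                   ≡⟨ sym (vert-rot T (glue T c)) ⟩
  vert T (rot (glue T) (glue T c))    ≡⟨ cong (λ d → vert T (proj₁ d , next (proj₂ d))) (glue-invol T c) ⟩
  vert T (proj₁ c , next (proj₂ c))   ∎

_≟ᶜ_ : (a b : Color) → Dec (a ≡ b)
red ≟ᶜ red = yes refl
red ≟ᶜ green = no (λ ())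
red ≟ᶜ blue = no (λ ())
green ≟ᶜ red = no (λ ())
green ≟ᶜ green = yes refl
green ≟ᶜ blue = no (λ ())
blue ≟ᶜ red = no (λ ())
blue ≟ᶜ green = no (λ ())
blue ≟ᶜ blue = yes refl

black? : (T : Trinity) (t : Fin (F T)) → Dec (Black T t)
black? T t = any? λ i → (colC T (t , i) ≟ᶜ blue)
                  ×-dec ((colC T (t , next i) ≟ᶜ green)
                  ×-dec (colC T (t , next (next i)) ≟ᶜ red))

module ClockMoves (T : Trinity) (fr : Frame T) where

  pointer : State fr → Fin (F T) → Fin 3
  pointer s = proj₁ s

  -- Only black triangles are changed by clock moves, so exponent sums of
  -- white triangles vanish.
  exponentSum-white : ∀ {s e} (p : Path fr s e) x → White T x → exponentSum fr p x ≡ 0ℤ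
  exponentSum-white [] x white = refl
  exponentSum-white (cw Δ mv p) x white with Δ ≟ x
  ... | yes refl = ⊥-elim (white (proj₁ (proj₁ mv)))
  ... | no _ = exponentSum-white p x white
  exponentSum-white (ccw Δ mv p) x white with Δ ≟ x
  ... | yes refl = ⊥-elim (white (proj₁ (proj₁ mv)))
  ... | no _ = exponentSum-white p x white

  exponentSums-agree : ∀ {s e e'} (P : Path fr s e) (P' : Path fr s e') →
    (∀ Δ → Black T Δ → exponentSum fr P Δ ≡ exponentSum fr P' Δ) →
    ∀ x → exponentSum fr P x ≡ exponentSum fr P' x
  exponentSums-agree P P' onBlack x with black? T x
  ... | yes black = onBlack x black
  ... | no white = trans (exponentSum-white P x white) (sym (exponentSum-white P' x white))

  indicator : Fin (F T) → Fin (F T) → ℤ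
  indicator Δ x with Δ ≟ x
  ... | yes _ = 1ℤ
  ... | no _ = 0ℤ

  exponentSum-cw : ∀ {s s' e} Δ (mv : CWMove fr Δ s s') (p : Path fr s' e) x →
    exponentSum fr (cw {s = s} Δ mv p) x ≡ exponentSum fr p x +ℤ indicator Δ x
  exponentSum-cw Δ mv p x with Δ ≟ x
  ... | yes _ = ℤP.+-comm 1ℤ (exponentSum fr p x)
  ... | no _ = sym (ℤP.+-identityʳ _)

  exponentSum-ccw : ∀ {s s' e} Δ (mv : CCWMove fr Δ s s') (p : Path fr s' e) x →
    exponentSum fr (ccw {s = s} Δ mv p) x +ℤ indicator Δ x ≡ exponentSum fr p x
  exponentSum-ccw Δ mv p x with Δ ≟ x
  ... | yes _ = cancel (exponentSum fr p x)
    where cancel : ∀ a → ((- 1ℤ) +ℤ a) +ℤ 1ℤ ≡ a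
          cancel = solve-∀
  ... | no _ = ℤP.+-identityʳ _

  -- around f t: the sum of f over the three neighbours of t.  In particular
  -- around (indicator Δ) t counts the sides that t shares with Δ.
  around : (Fin (F T) → ℤ) → Fin (F T) → ℤ
  around f t = sum λ j → f (Wtri fr t j)

  around-cong : ∀ {f g} t → (∀ x → f x ≡ g x) → around f t ≡ around g t
  around-cong t f≗g = sum-cong-≗ (λ j → f≗g (Wtri fr t j))

  around-cw : ∀ {s s' e} Δ (mv : CWMove fr Δ s s') (p : Path fr s' e) t →
    around (exponentSum fr (cw {s = s} Δ mv p)) t ≡ around (exponentSum fr p) t +ℤ around (indicator Δ) t
  around-cw {s} Δ mv p t =
    trans (around-cong {g = λ x → exponentSum fr p x +ℤ indicator Δ x} t (exponentSum-cw {s} Δ mv p))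
          (∑-distrib-+ (λ j → exponentSum fr p (Wtri fr t j)) (λ j → indicator Δ (Wtri fr t j)))

  around-ccw : ∀ {s s' e} Δ (mv : CCWMove fr Δ s s') (p : Path fr s' e) t →
    around (exponentSum fr (ccw {s = s} Δ mv p)) t +ℤ around (indicator Δ) t ≡ around (exponentSum fr p) t
  around-ccw {s} Δ mv p t =
    trans (sym (∑-distrib-+ (λ j → exponentSum fr (ccw {s = s} Δ mv p) (Wtri fr t j))
                            (λ j → indicator Δ (Wtri fr t j))))
          (around-cong {f = λ x → exponentSum fr (ccw {s = s} Δ mv p) x +ℤ indicator Δ x} t
                       (exponentSum-ccw {s} Δ mv p))

  matched-corner : ∀ {s t j} → Matches fr s t (vert T (t , j)) → pointer s t ≡ j
  matched-corner {t = t} m = corner-injective T t (proj₂ m)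

  across-back : ∀ Δ i → Wtri fr (Wtri fr Δ i) (proj₂ (glue T (Δ , i))) ≡ Δ
  across-back Δ i = cong proj₁ (glue-invol T (Δ , i))

  cw-across : ∀ {s s'} t j → CWMove fr (Wtri fr t j) s s' →
              pointer s t ≡ j × pointer s' t ≡ next j
  cw-across {s} {s'} t j ((_ , before) , after , _) =
      matched-corner {s} (subst₂ (Matches fr s) (across-back t j) (vert-rot T (t , j)) (before i))
    , matched-corner {s'} (subst₂ (Matches fr s') (across-back t j) (glued-side-start T (t , j)) (after i))
    where i = proj₂ (glue T (t , j))

  cw-across-next : ∀ {s s'} t j → CWMove fr (Wtri fr t j) s s' → pointer s' t ≡ next (pointer s t)
  cw-across-next {s} {s'} t j mv =
    trans (proj₂ (cw-across {s} {s'} t j mv)) (cong next (sym (proj₁ (cw-across {s} {s'} t j mv))))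

  cw-far : ∀ {Δ s s'} t → CWMove fr Δ s s' → RelTri fr t → (∀ j → Δ ≢ Wtri fr t j) →
           pointer s' t ≡ pointer s t
  cw-far {Δ} t (_ , _ , unchanged) rt far = corner-injective T t (unchanged t rt notNeighbour)
    where
      notNeighbour : ∀ i → t ≢ Wtri fr Δ i
      notNeighbour i t≡ = far (proj₂ (glue T (Δ , i)))
                             (sym (subst (λ w → Wtri fr w (proj₂ (glue T (Δ , i))) ≡ Δ) (sym t≡) (across-back Δ i)))

  cw-one-side : ∀ {Δ s s'} t {j k} → CWMove fr Δ s s' → Δ ≡ Wtri fr t j → Δ ≡ Wtri fr t k → j ≡ k
  cw-one-side {s = s} {s'} t {j} {k} mv refl Δ≡k =
    trans (sym (proj₁ (cw-across {s} {s'} t j mv)))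
          (proj₁ (cw-across {s} {s'} t k (subst (λ d → CWMove fr d s s') Δ≡k mv)))

  -- A clockwise move of Δ turns the pointer of t by the number of sides it
  -- shares with Δ; that number is never two or three, by `cw-one-side`.
  cw-rotates : ∀ {Δ s s'} t → CWMove fr Δ s s' → RelTri fr t →
               pointer s' t ≡ rotate (around (indicator Δ) t) (pointer s t)
  cw-rotates {Δ} {s} {s'} t mv rt
    with Δ ≟ Wtri fr t zero | Δ ≟ Wtri fr t (suc zero) | Δ ≟ Wtri fr t (suc (suc zero))
  ... | yes e₀ | yes e₁ | _ with cw-one-side {s = s} {s'} t mv e₀ e₁
  ...   | ()
  cw-rotates {s = s} {s'} t mv rt | yes e₀ | no _ | yes e₂ with cw-one-side {s = s} {s'} t mv e₀ e₂
  ...   | ()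
  cw-rotates {s = s} {s'} t mv rt | no _ | yes e₁ | yes e₂ with cw-one-side {s = s} {s'} t mv e₁ e₂
  ...   | ()
  cw-rotates {s = s} {s'} t mv rt | yes refl | no _ | no _ = cw-across-next {s} {s'} t zero mv
  cw-rotates {s = s} {s'} t mv rt | no _ | yes refl | no _ = cw-across-next {s} {s'} t (suc zero) mv
  cw-rotates {s = s} {s'} t mv rt | no _ | no _ | yes refl = cw-across-next {s} {s'} t (suc (suc zero)) mv
  cw-rotates {Δ} {s} {s'} t mv rt | no n₀ | no n₁ | no n₂ = cw-far {s = s} {s'} t mv rt far
    where far : ∀ j → Δ ≢ Wtri fr t j
          far zero = n₀
          far (suc zero) = n₁
          far (suc (suc zero)) = n₂

  pointer-along : ∀ {s e} (p : Path fr s e) t → RelTri fr t →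
                  pointer e t ≡ rotate (around (exponentSum fr p) t) (pointer s t)
  pointer-along [] t rt = refl
  pointer-along {s} {e} (cw {s' = s'} Δ mv p) t rt = begin
    pointer e t                              ≡⟨ pointer-along p t rt ⟩
    rotate rest (pointer s' t)               ≡⟨ cong (rotate rest) (cw-rotates {s = s} {s'} t mv rt) ⟩
    rotate rest (rotate shared (pointer s t)) ≡⟨ sym (rotate-+ rest shared (pointer s t)) ⟩
    rotate (rest +ℤ shared) (pointer s t)    ≡⟨ cong (λ a → rotate a (pointer s t)) (sym (around-cw {s} Δ mv p t)) ⟩
    rotate (around (exponentSum fr (cw {s = s} Δ mv p)) t) (pointer s t) ∎
    where
      rest shared : ℤ
      rest = around (exponentSum fr p) t
      shared = around (indicator Δ) t
  pointer-along {s} {e} (ccw {s' = s'} Δ mv p) t rt = begin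
    pointer e t                                ≡⟨ pointer-along p t rt ⟩
    rotate rest (pointer s' t)                 ≡⟨ cong (λ a → rotate a (pointer s' t)) (sym (around-ccw {s} Δ mv p t)) ⟩
    rotate (whole +ℤ shared) (pointer s' t)    ≡⟨ rotate-+ whole shared (pointer s' t) ⟩
    rotate whole (rotate shared (pointer s' t)) ≡⟨ cong (rotate whole) (sym (cw-rotates {s = s'} {s} t mv rt)) ⟩
    rotate whole (pointer s t)                 ∎
    where
      rest whole shared : ℤ
      rest = around (exponentSum fr p) t
      whole = around (exponentSum fr (ccw {s = s} Δ mv p)) t
      shared = around (indicator Δ) t

lemma3p1 : (T : Trinity) (fr : Frame T) → Irreducible T →
    (s e e' : State fr) (P : Path fr s e) (P' : Path fr s e') →
    (∀ Δ → Trinity.Black T Δ → exponentSum fr P Δ ≡ exponentSum fr P' Δ) →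
    SameState fr e e'
lemma3p1 T fr _ s e e' P P' sameOnBlack t rt = cong (λ j → vert T (t , j)) (begin
  pointer e t                                          ≡⟨ pointer-along P t rt ⟩
  rotate (around (exponentSum fr P) t) (pointer s t)   ≡⟨ cong (λ a → rotate a (pointer s t)) sameAround ⟩
  rotate (around (exponentSum fr P') t) (pointer s t)  ≡⟨ sym (pointer-along P' t rt) ⟩
  pointer e' t                                         ∎)
  where
    open ClockMoves T fr
    sameAround : around (exponentSum fr P) t ≡ around (exponentSum fr P') t
    sameAround = around-cong t (exponentSums-agree P P' sameOnBlack)
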